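{- Let $f$ be a function from the positive integers to the integers, and let $M,N$ be positive integers. Then \[ \sum_{i=1}^{N}\frac{q^{f(i)}\,u_{f(i+M)-f(i)}}{w_{f(i)}\,w_{f(i+M)}}=\sum_{i=1}^{M}\frac{q^{f(i)}\,u_{f(i+N)-f(i)}}{w_{f(i)}\,w_{f(i+N)}}. \]
   Context: Let $a,b,p,q$ be complex numbers. The generalized Lucas sequence $w_n=w_n(a,b;p,q)$ is defined by $w_0=a$, $w_1=b$, $w_n=pw_{n-1}-qw_{n-2}$, and the Lucas sequence of the first kind is $u_n=u_n(p,q)=w_n(0,1;p,q)$. Let $\alpha,\beta$ be the roots of $x^2-px+q=0$, labeled so that $|\alpha|>|\beta|$, with discriminant $D=p^2-4q\neq 0$; thus $\alpha+\beta=p$, $\alpha\beta=q$, $\alpha-\beta=\sqrt D$. With $A=b-a\beta$ and $B=b-a\alpha$ one has the Binet formulas $w_n=(A\alpha^n-B\beta^n)/(\alpha-\beta)$ and $u_n=(\alpha^n-\beta^n)/(\alpha-\beta)$; these formulas also define $w_n,u_n$ for negative integers $n$ (with $q\neq0$ understood whenever negative indices occur). As implicit in the statement, all denominators appearing are assumed nonzero. -}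

module Defs where

open import Level using (Level; _⊔_) renaming (suc to lsuc)
open import Algebra.Bundles using (CommutativeRing)
open import Data.Nat as ℕ using (ℕ; zero; suc)
open import Data.Integer as ℤ using (ℤ; +_; -[1+_])
open import Relation.Nullary using (¬_)

-- A (discrete) field: a commutative ring with 1 ≠ 0 and a total
-- inverse function that is a two-sided inverse on nonzero elements
-- (the value of 0⁻¹ is unspecified).  ℂ is an instance.
record Field (c ℓ : Level) : Set (lsuc (c ⊔ ℓ)) where
  field
    commutativeRing : CommutativeRing c ℓ
  open CommutativeRing commutativeRing public
  field
    _⁻¹     : Carrier → Carrier
    1≉0     : ¬ (1# ≈ 0#)
    inverse : ∀ x → ¬ (x ≈ 0#) → (x * x ⁻¹) ≈ 1#
  infixl 7 _/_
  _/_ : Carrier → Carrier → Carrier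
  x / y = x * y ⁻¹

module Lucas {c ℓ : Level} (F : Field c ℓ) where
  open Field F

  pow : Carrier → ℕ → Carrier
  pow x zero    = 1#
  pow x (suc n) = x * pow x n

  powℤ : Carrier → ℤ → Carrier
  powℤ x (+ n)      = pow x n
  powℤ x -[1+ k ]   = pow (x ⁻¹) (suc k)

  module _ (a b p q : Carrier) where
    wNat : ℕ → Carrier
    wNat zero          = a
    wNat (suc zero)    = b
    wNat (suc (suc n)) = p * wNat (suc n) - q * wNat n

    -- wNeg k = w_{-k}, the recurrence run backwards:
    -- w_{m-2} = (p w_{m-1} - w_m) / q   (this agrees with the Binet formula)
    wNeg : ℕ → Carrier
    wNeg zero          = a
    wNeg (suc zero)    = (p * a - b) / q
    wNeg (suc (suc k)) = (p * wNeg (suc k) - wNeg k) / q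

    w : ℤ → Carrier
    w (+ n)      = wNat n
    w -[1+ k ]   = wNeg (suc k)

  u : Carrier → Carrier → ℤ → Carrier
  u p q = w 0# 1# p q

  sum1 : ℕ → (ℕ → Carrier) → Carrier
  sum1 zero    g = 0#
  sum1 (suc n) g = sum1 n g + g (suc n)

module Submission where

open import Defs
open import Level using (Level)
open import Algebra.Bundles using (CommutativeRing)
open import Algebra.Solver.Ring.AlmostCommutativeRing
  using (_-Raw-AlmostCommutative⟶_; fromCommutativeRing)
open import Data.Nat as ℕ using (ℕ; zero; suc; _≤_)
import Data.Nat.Properties as ℕP
open import Data.Integer as ℤ using (ℤ; +_; -[1+_])
import Data.Integer.Properties as ℤP
open import Data.Integer.Tactic.RingSolver using (solve-∀)
open import Data.Maybe using (Maybe; just; nothing)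
open import Data.Product using (_×_; _,_; proj₁; proj₂)
open import Data.Sum using (_⊎_; inj₁; inj₂; map₂)
open import Function using (_∘_)
open import Relation.Nullary using (¬_; yes; no)
open import Relation.Binary.PropositionalEquality as ≡ using (_≡_)

-- Any two solutions x, y of the recurrence X(k+2) = p X(k+1) − q X(k)
-- satisfy x(n) y(m) − x(m) y(n) = q^m u(n−m) (x(1) y(0) − x(0) y(1)):
-- as a function of d = n − m the left side is again a solution, with
-- initial values 0 and the Casoratian at m, which is q^m times the one
-- at 0.  Taking y = w and x = w(c,d;p,q) turns every summand, multiplied
-- by K = d a − c b, into a difference G(i+k) − G(i) with G(i) = x/w at
-- f(i), so both sums telescope to the same value.  Choosing (c, d) with
-- K = w(f(1)), which is nonzero, then gives the identity.

-- The ring solver decides equality of coefficients, so taking them in ℤ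
-- lets it see cancellations such as x − x = 0 in an arbitrary ring.
module IntegerCoefficients {c ℓ : Level} (R : CommutativeRing c ℓ) where
  open CommutativeRing R
  open import Algebra.Properties.Semiring.Mult.TCOptimised semiring
    using (1+×; ×-homo-+; ×1-homo-*)
    renaming (_×_ to _·_)
  open import Algebra.Properties.AbelianGroup +-abelianGroup using (⁻¹-∙-comm)
  open import Algebra.Properties.Group +-group using (ε⁻¹≈ε; ⁻¹-involutive)
  open import Algebra.Properties.Ring ring using (-‿distribˡ-*; -‿distribʳ-*)
  open import Relation.Binary.Reasoning.Setoid setoid

  fromℕ : ℕ → Carrier
  fromℕ n = n · 1#

  fromℤ : ℤ → Carrier
  fromℤ (+ n)      = fromℕ n
  fromℤ -[1+ n ]   = - fromℕ (suc n)

  fromℤ-⊖ : ∀ m n → fromℤ (m ℤ.⊖ n) ≈ fromℕ m - fromℕ n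
  fromℤ-⊖ zero    zero    = sym (-‿inverseʳ 0#)
  fromℤ-⊖ zero    (suc n) = sym (+-identityˡ _)
  fromℤ-⊖ (suc m) zero    = sym (trans (+-congˡ ε⁻¹≈ε) (+-identityʳ _))
  fromℤ-⊖ (suc m) (suc n) = begin
    fromℤ (suc m ℤ.⊖ suc n)          ≡⟨ ≡.cong fromℤ (ℤP.[1+m]⊖[1+n]≡m⊖n m n) ⟩
    fromℤ (m ℤ.⊖ n)                  ≈⟨ fromℤ-⊖ m n ⟩
    fromℕ m - fromℕ n                ≈⟨ +-identityˡ _ ⟨
    0# + (fromℕ m - fromℕ n)         ≈⟨ +-congʳ (-‿inverseʳ 1#) ⟨
    (1# - 1#) + (fromℕ m - fromℕ n)  ≈⟨ +-assoc 1# (- 1#) _ ⟩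
    1# + (- 1# + (fromℕ m - fromℕ n)) ≈⟨ +-congˡ (+-congˡ (+-comm _ _)) ⟩
    1# + (- 1# + (- fromℕ n + fromℕ m)) ≈⟨ +-congˡ (+-assoc _ _ _) ⟨
    1# + ((- 1# - fromℕ n) + fromℕ m) ≈⟨ +-congˡ (+-comm _ _) ⟩
    1# + (fromℕ m + (- 1# - fromℕ n)) ≈⟨ +-assoc _ _ _ ⟨
    1# + fromℕ m + (- 1# - fromℕ n)  ≈⟨ +-congʳ (1+× m 1#) ⟨
    fromℕ (suc m) + (- 1# - fromℕ n) ≈⟨ +-congˡ (⁻¹-∙-comm 1# (fromℕ n)) ⟩
    fromℕ (suc m) - (1# + fromℕ n)   ≈⟨ +-congˡ (-‿cong (1+× n 1#)) ⟨
    fromℕ (suc m) - fromℕ (suc n)    ∎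

  fromℤ-+ : ∀ i j → fromℤ (i ℤ.+ j) ≈ fromℤ i + fromℤ j
  fromℤ-+ -[1+ m ] -[1+ n ] = begin
    - fromℕ (suc (suc (m ℕ.+ n)))       ≡⟨ ≡.cong (-_ ∘ fromℕ ∘ suc) (ℕP.+-suc m n) ⟨
    - fromℕ (suc m ℕ.+ suc n)           ≈⟨ -‿cong (×-homo-+ 1# (suc m) (suc n)) ⟩
    - (fromℕ (suc m) + fromℕ (suc n))   ≈⟨ ⁻¹-∙-comm _ _ ⟨
    - fromℕ (suc m) - fromℕ (suc n)     ∎
  fromℤ-+ -[1+ m ] (+ n)    = trans (fromℤ-⊖ n (suc m)) (+-comm _ _)
  fromℤ-+ (+ m)    -[1+ n ] = fromℤ-⊖ m (suc n)
  fromℤ-+ (+ m)    (+ n)    = ×-homo-+ 1# m n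

  fromℤ-neg : ∀ i → fromℤ (ℤ.- i) ≈ - fromℤ i
  fromℤ-neg -[1+ n ]    = sym (⁻¹-involutive _)
  fromℤ-neg (+ zero)    = sym ε⁻¹≈ε
  fromℤ-neg (+ (suc n)) = refl

  fromℤ-*-pos : ∀ i n → fromℤ (i ℤ.* + n) ≈ fromℤ i * fromℕ n
  fromℤ-*-pos (+ m)    n = trans (reflexive (≡.cong fromℤ (≡.sym (ℤP.pos-* m n)))) (×1-homo-* m n)
  fromℤ-*-pos -[1+ m ] n = begin
    fromℤ (-[1+ m ] ℤ.* + n)          ≡⟨ ≡.cong fromℤ (ℤP.neg-distribˡ-* (+ suc m) (+ n)) ⟨
    fromℤ (ℤ.- (+ suc m ℤ.* + n))     ≈⟨ fromℤ-neg (+ suc m ℤ.* + n) ⟩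
    - fromℤ (+ suc m ℤ.* + n)         ≈⟨ -‿cong (fromℤ-*-pos (+ suc m) n) ⟩
    - (fromℕ (suc m) * fromℕ n)       ≈⟨ -‿distribˡ-* _ _ ⟩
    - fromℕ (suc m) * fromℕ n         ∎

  fromℤ-* : ∀ i j → fromℤ (i ℤ.* j) ≈ fromℤ i * fromℤ j
  fromℤ-* i (+ n)    = fromℤ-*-pos i n
  fromℤ-* i -[1+ n ] = begin
    fromℤ (i ℤ.* -[1+ n ])            ≡⟨ ≡.cong fromℤ (ℤP.neg-distribʳ-* i (+ suc n)) ⟨
    fromℤ (ℤ.- (i ℤ.* + suc n))       ≈⟨ fromℤ-neg (i ℤ.* + suc n) ⟩
    - fromℤ (i ℤ.* + suc n)           ≈⟨ -‿cong (fromℤ-*-pos i (suc n)) ⟩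
    - (fromℤ i * fromℕ (suc n))       ≈⟨ -‿distribʳ-* _ _ ⟩
    fromℤ i * - fromℕ (suc n)         ∎

  fromℤ-homomorphism : ℤ.+-*-rawRing -Raw-AlmostCommutative⟶ fromCommutativeRing R
  fromℤ-homomorphism = record
    { ⟦_⟧    = fromℤ
    ; +-homo = fromℤ-+
    ; *-homo = fromℤ-*
    ; -‿homo = fromℤ-neg
    ; 0-homo = refl
    ; 1-homo = refl
    }

  fromℤ-≟ : ∀ i j → Maybe (fromℤ i ≈ fromℤ j)
  fromℤ-≟ i j with i ℤ.≟ j
  ... | yes ≡.refl = just refl
  ... | no _       = nothing

  open import Algebra.Solver.Ring ℤ.+-*-rawRing (fromCommutativeRing R)
    fromℤ-homomorphism fromℤ-≟ public

-- ℤ.suc d unfolds to 1ℤ + d; spelled out so that the ℤ ring solver can read it.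
ℤ-+-sucʳ : ∀ m d → m ℤ.+ (ℤ.1ℤ ℤ.+ d) ≡ ℤ.1ℤ ℤ.+ (m ℤ.+ d)
ℤ-+-sucʳ = solve-∀

m+[n-m]≡n : ∀ m n → m ℤ.+ (n ℤ.- m) ≡ n
m+[n-m]≡n = solve-∀

module LucasTelescoping {c ℓ : Level} (F : Field c ℓ) where
  open Field F
  open Lucas F
  open IntegerCoefficients commutativeRing using (solve; con; _:+_; _:-_; _:*_; _:=_)
  open import Relation.Binary.Reasoning.Setoid setoid

  x⁻¹*[x*y]≈y : ∀ {x} → x ≉ 0# → ∀ y → x ⁻¹ * (x * y) ≈ y
  x⁻¹*[x*y]≈y {x} x≉0 y = begin
    x ⁻¹ * (x * y)  ≈⟨ *-assoc _ _ _ ⟨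
    x ⁻¹ * x * y    ≈⟨ *-congʳ (trans (*-comm _ _) (inverse x x≉0)) ⟩
    1# * y          ≈⟨ *-identityˡ y ⟩
    y               ∎

  x*[y/x]≈y : ∀ {x} → x ≉ 0# → ∀ y → x * (y / x) ≈ y
  x*[y/x]≈y {x} x≉0 y = begin
    x * (y * x ⁻¹)  ≈⟨ solve 3 (λ x y x' → x :* (y :* x') := y :* (x :* x')) refl x y (x ⁻¹) ⟩
    y * (x * x ⁻¹)  ≈⟨ *-congˡ (inverse x x≉0) ⟩
    y * 1#          ≈⟨ *-identityʳ y ⟩
    y               ∎

  *-cancelˡ : ∀ {x y z} → x ≉ 0# → x * y ≈ x * z → y ≈ z
  *-cancelˡ x≉0 xy≈xz =
    trans (sym (x⁻¹*[x*y]≈y x≉0 _)) (trans (*-congˡ xy≈xz) (x⁻¹*[x*y]≈y x≉0 _))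

  x*y≉0 : ∀ {x y} → x ≉ 0# → y ≉ 0# → x * y ≉ 0#
  x*y≉0 {x} x≉0 y≉0 xy≈0 = y≉0 (*-cancelˡ x≉0 (trans xy≈0 (sym (zeroʳ x))))

  /-sub-/ : ∀ {y z} → y ≉ 0# → z ≉ 0# → ∀ s t → s / y - t / z ≈ (s * z - t * y) / (z * y)
  /-sub-/ {y} {z} y≉0 z≉0 s t = *-cancelˡ (x*y≉0 z≉0 y≉0) (begin
    z * y * (s * y ⁻¹ - t * z ⁻¹)
      ≈⟨ solve 6 (λ s t y z y' z' → z :* y :* (s :* y' :- t :* z')
                                   := s :* z :* (y :* y') :- t :* y :* (z :* z'))
               refl s t y z (y ⁻¹) (z ⁻¹) ⟩
    s * z * (y * y ⁻¹) - t * y * (z * z ⁻¹)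
      ≈⟨ +-cong (*-congˡ (inverse y y≉0)) (-‿cong (*-congˡ (inverse z z≉0))) ⟩
    s * z * 1# - t * y * 1#
      ≈⟨ +-cong (*-identityʳ _) (-‿cong (*-identityʳ _)) ⟩
    s * z - t * y
      ≈⟨ x*[y/x]≈y (x*y≉0 z≉0 y≉0) _ ⟨
    z * y * ((s * z - t * y) / (z * y)) ∎)

  sum1-cong : ∀ n {g h : ℕ → Carrier} → (∀ i → 1 ≤ i → i ≤ n → g i ≈ h i) → sum1 n g ≈ sum1 n h
  sum1-cong zero    g≈h = refl
  sum1-cong (suc n) g≈h =
    +-cong (sum1-cong n (λ i 1≤i i≤n → g≈h i 1≤i (ℕP.m≤n⇒m≤1+n i≤n))) (g≈h (suc n) (ℕ.s≤s ℕ.z≤n) ℕP.≤-refl)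

  *-distribˡ-sum1 : ∀ x n (g : ℕ → Carrier) → x * sum1 n g ≈ sum1 n (λ i → x * g i)
  *-distribˡ-sum1 x zero    g = zeroʳ x
  *-distribˡ-sum1 x (suc n) g = trans (distribˡ _ _ _) (+-congʳ (*-distribˡ-sum1 x n g))

  sum1-shift-sub : ∀ (G : ℕ → Carrier) k n →
    sum1 n (λ i → G (i ℕ.+ k) - G i) ≈ sum1 (n ℕ.+ k) G - sum1 k G - sum1 n G
  sum1-shift-sub G k zero    = sym (trans (+-congʳ (-‿inverseʳ _)) (-‿inverseʳ 0#))
  sum1-shift-sub G k (suc n) = begin
    sum1 n (λ i → G (i ℕ.+ k) - G i) + (G (suc n ℕ.+ k) - G (suc n))
      ≈⟨ +-congʳ (sum1-shift-sub G k n) ⟩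
    sum1 (n ℕ.+ k) G - sum1 k G - sum1 n G + (G (suc n ℕ.+ k) - G (suc n))
      ≈⟨ solve 5 (λ A B C g h → A :- B :- C :+ (g :- h) := A :+ g :- B :- (C :+ h)) refl _ _ _ _ _ ⟩
    sum1 (suc n ℕ.+ k) G - sum1 k G - sum1 (suc n) G ∎

  sum1-telescope-swap : ∀ (G : ℕ → Carrier) k n →
    sum1 n (λ i → G (i ℕ.+ k) - G i) ≈ sum1 k (λ i → G (i ℕ.+ n) - G i)
  sum1-telescope-swap G k n = begin
    sum1 n (λ i → G (i ℕ.+ k) - G i)          ≈⟨ sum1-shift-sub G k n ⟩
    sum1 (n ℕ.+ k) G - sum1 k G - sum1 n G    ≡⟨ ≡.cong (λ j → sum1 j G - sum1 k G - sum1 n G) (ℕP.+-comm n k) ⟩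
    sum1 (k ℕ.+ n) G - sum1 k G - sum1 n G
      ≈⟨ solve 3 (λ A B C → A :- B :- C := A :- C :- B) refl _ _ _ ⟩
    sum1 (k ℕ.+ n) G - sum1 n G - sum1 k G    ≈⟨ sum1-shift-sub G n k ⟨
    sum1 k (λ i → G (i ℕ.+ n) - G i)          ∎

  module Recurrence (p q : Carrier) where

    Solution : {I : Set} → (I → I) → (I → Carrier) → Set ℓ
    Solution s x = ∀ k → x (s (s k)) ≈ p * x (s k) - q * x k

    module _ {I : Set} (s : I → I) where

      Casoratian : (x y : I → Carrier) → I → Carrier
      Casoratian x y k = x (s k) * y k - x k * y (s k)

      casoratian-step : ∀ {x y} → Solution s x → Solution s y →
                        ∀ k → Casoratian x y (s k) ≈ q * Casoratian x y k
      casoratian-step {x} {y} sx sy k = begin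
        x (s (s k)) * y (s k) - x (s k) * y (s (s k))
          ≈⟨ +-cong (*-congʳ (sx k)) (-‿cong (*-congˡ (sy k))) ⟩
        (p * x (s k) - q * x k) * y (s k) - x (s k) * (p * y (s k) - q * y k)
          ≈⟨ solve 6 (λ p q x₀ x₁ y₀ y₁ → (p :* x₁ :- q :* x₀) :* y₁ :- x₁ :* (p :* y₁ :- q :* y₀)
                                         := q :* (x₁ :* y₀ :- x₀ :* y₁))
                   refl p q (x k) (x (s k)) (y k) (y (s k)) ⟩
        q * Casoratian x y k ∎

      reindex : ∀ {x} (t : I → I) → (∀ k → t (s k) ≡ s (t k)) → Solution s x → Solution s (x ∘ t)
      reindex {x} t t∘s≡s∘t sx k = begin
        x (t (s (s k)))                ≡⟨ ≡.cong x (≡.trans (t∘s≡s∘t (s k)) (≡.cong s (t∘s≡s∘t k))) ⟩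
        x (s (s (t k)))                ≈⟨ sx (t k) ⟩
        p * x (s (t k)) - q * x (t k)  ≡⟨ ≡.cong (λ j → p * x j - q * x (t k)) (t∘s≡s∘t k) ⟨
        p * x (t (s k)) - q * x (t k)  ∎

      combination : ∀ {x y} α β → Solution s x → Solution s y → Solution s (λ k → x k * α - β * y k)
      combination {x} {y} α β sx sy k = begin
        x (s (s k)) * α - β * y (s (s k))
          ≈⟨ +-cong (*-congʳ (sx k)) (-‿cong (*-congˡ (sy k))) ⟩
        (p * x (s k) - q * x k) * α - β * (p * y (s k) - q * y k)
          ≈⟨ solve 8 (λ p q x₀ x₁ y₀ y₁ α β → (p :* x₁ :- q :* x₀) :* α :- β :* (p :* y₁ :- q :* y₀)
                                             := p :* (x₁ :* α :- β :* y₁) :- q :* (x₀ :* α :- β :* y₀))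
                   refl p q _ _ _ _ α β ⟩
        p * (x (s k) * α - β * y (s k)) - q * (x k * α - β * y k) ∎

      scaled : ∀ {x} γ → Solution s x → Solution s (λ k → x k * γ)
      scaled {x} γ sx k = trans (*-congʳ (sx k))
        (solve 5 (λ p q x₀ x₁ γ → (p :* x₁ :- q :* x₀) :* γ := p :* (x₁ :* γ) :- q :* (x₀ :* γ))
               refl p q (x k) (x (s k)) γ)

      solution-step : ∀ {x y} → Solution s x → Solution s y → ∀ {k} →
        x k ≈ y k → x (s k) ≈ y (s k) → x (s (s k)) ≈ y (s (s k))
      solution-step sx sy {k} e₀ e₁ =
        trans (sx k) (trans (+-cong (*-congˡ e₁) (-‿cong (*-congˡ e₀))) (sym (sy k)))

      solution-step-back : q ≉ 0# → ∀ {x y} → Solution s x → Solution s y → ∀ {k} →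
        x (s k) ≈ y (s k) → x (s (s k)) ≈ y (s (s k)) → x k ≈ y k
      solution-step-back q≉0 {x} {y} sx sy {k} e₁ e₂ = *-cancelˡ q≉0 (begin
        q * x k                            ≈⟨ q*z₀ sx ⟩
        p * x (s k) - x (s (s k))          ≈⟨ +-cong (*-congˡ e₁) (-‿cong e₂) ⟩
        p * y (s k) - y (s (s k))          ≈⟨ q*z₀ sy ⟨
        q * y k                            ∎)
        where
        q*z₀ : ∀ {z} → Solution s z → q * z k ≈ p * z (s k) - z (s (s k))
        q*z₀ {z} sz = trans
          (solve 4 (λ p q z₀ z₁ → q :* z₀ := p :* z₁ :- (p :* z₁ :- q :* z₀)) refl p q (z k) (z (s k)))
          (+-congˡ (-‿cong (sym (sz k))))

      module _ (_⊕_ : I → I → I) (o : I)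
               (⊕-identityʳ : ∀ m → m ⊕ o ≡ m) (⊕-suc : ∀ m d → m ⊕ s d ≡ s (m ⊕ d))
               (unique : ∀ {x y} → Solution s x → Solution s y →
                         x o ≈ y o → x (s o) ≈ y (s o) → ∀ k → x k ≈ y k)
               {v : I → Carrier} (v-solution : Solution s v) (v-o : v o ≈ 0#) (v-so : v (s o) ≈ 1#)
               where

        cross-difference : ∀ {x y} → Solution s x → Solution s y → ∀ m d →
          x (m ⊕ d) * y m - x m * y (m ⊕ d) ≈ v d * Casoratian x y m
        cross-difference {x} {y} sx sy m = unique
          (combination (y m) (x m) (reindex (m ⊕_) (⊕-suc m) sx) (reindex (m ⊕_) (⊕-suc m) sy))
          (scaled (Casoratian x y m) v-solution)
          (begin
            x (m ⊕ o) * y m - x m * y (m ⊕ o)  ≡⟨ ≡.cong (λ j → x j * y m - x m * y j) (⊕-identityʳ m) ⟩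
            x m * y m - x m * y m              ≈⟨ -‿inverseʳ _ ⟩
            0#                                 ≈⟨ zeroˡ _ ⟨
            0# * Casoratian x y m              ≈⟨ *-congʳ v-o ⟨
            v o * Casoratian x y m             ∎)
          (begin
            x (m ⊕ s o) * y m - x m * y (m ⊕ s o)
              ≡⟨ ≡.cong (λ j → x j * y m - x m * y j) (≡.trans (⊕-suc m o) (≡.cong s (⊕-identityʳ m))) ⟩
            Casoratian x y m         ≈⟨ *-identityˡ _ ⟨
            1# * Casoratian x y m    ≈⟨ *-congʳ v-so ⟨
            v (s o) * Casoratian x y m ∎)

    wNat-solution : ∀ a b → Solution suc (wNat a b p q)
    wNat-solution a b k = refl

    solution-uniqueℕ : ∀ {x y} → Solution suc x → Solution suc y →
                       x 0 ≈ y 0 → x 1 ≈ y 1 → ∀ k → x k ≈ y k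
    solution-uniqueℕ {x} {y} sx sy e₀ e₁ k = proj₁ (agree k)
      where
      agree : ∀ k → x k ≈ y k × x (suc k) ≈ y (suc k)
      agree zero    = e₀ , e₁
      agree (suc k) = proj₂ (agree k) , solution-step suc sx sy (proj₁ (agree k)) (proj₂ (agree k))

    casoratian-powℕ : ∀ {x y} → Solution suc x → Solution suc y →
                      ∀ m → Casoratian suc x y m ≈ pow q m * Casoratian suc x y 0
    casoratian-powℕ sx sy zero    = sym (*-identityˡ _)
    casoratian-powℕ sx sy (suc m) =
      trans (casoratian-step suc sx sy m) (trans (*-congˡ (casoratian-powℕ sx sy m)) (sym (*-assoc _ _ _)))

    cross-differenceℕ : ∀ {x y} → Solution suc x → Solution suc y → ∀ m d →
      x (m ℕ.+ d) * y m - x m * y (m ℕ.+ d) ≈ wNat 0# 1# p q d * Casoratian suc x y m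
    cross-differenceℕ = cross-difference suc ℕ._+_ 0 ℕP.+-identityʳ ℕP.+-suc solution-uniqueℕ
                                         (wNat-solution 0# 1#) refl refl

    module Invertible (q≉0 : q ≉ 0#) where

      backward-step : ∀ A B → A ≈ p * B - q * ((p * B - A) / q)
      backward-step A B = begin
        A                              ≈⟨ solve 3 (λ A B p → A := p :* B :- (p :* B :- A)) refl A B p ⟩
        p * B - (p * B - A)            ≈⟨ +-congˡ (-‿cong (x*[y/x]≈y q≉0 _)) ⟨
        p * B - q * ((p * B - A) / q)  ∎

      w-solution : ∀ a b → Solution ℤ.suc (w a b p q)
      w-solution a b (+ k)                = refl
      w-solution a b -[1+ zero ]          = backward-step b a
      w-solution a b -[1+ suc zero ]      = backward-step _ _
      w-solution a b -[1+ suc (suc k) ]   = backward-step _ _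

      solution-uniqueℤ : ∀ {x y} → Solution ℤ.suc x → Solution ℤ.suc y →
                         x (+ 0) ≈ y (+ 0) → x (+ 1) ≈ y (+ 1) → ∀ k → x k ≈ y k
      solution-uniqueℤ sx sy e₀ e₁ (+ k)    = solution-uniqueℕ (sx ∘ +_) (sy ∘ +_) e₀ e₁ k
      solution-uniqueℤ {x} {y} sx sy e₀ e₁ -[1+ k ] = proj₁ (agree k)
        where
        agree : ∀ k → x -[1+ k ] ≈ y -[1+ k ] × x (ℤ.suc -[1+ k ]) ≈ y (ℤ.suc -[1+ k ])
        agree zero    = solution-step-back ℤ.suc q≉0 sx sy e₀ e₁ , e₀
        agree (suc k) = solution-step-back ℤ.suc q≉0 sx sy (proj₁ (agree k)) (proj₂ (agree k)) , proj₁ (agree k)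

      casoratian-powℤ : ∀ {x y} → Solution ℤ.suc x → Solution ℤ.suc y →
                        ∀ m → Casoratian ℤ.suc x y m ≈ powℤ q m * Casoratian ℤ.suc x y (+ 0)
      casoratian-powℤ sx sy (+ m)    = casoratian-powℕ (sx ∘ +_) (sy ∘ +_) m
      casoratian-powℤ {x} {y} sx sy -[1+ k ] = *-cancelˡ q≉0 (begin
        q * C -[1+ k ]                        ≈⟨ casoratian-step ℤ.suc sx sy -[1+ k ] ⟨
        C (ℤ.suc -[1+ k ])                    ≈⟨ above k ⟩
        pow (q ⁻¹) k * C (+ 0)                ≈⟨ q*[q⁻¹*z]≈z _ ⟨
        q * (q ⁻¹ * (pow (q ⁻¹) k * C (+ 0))) ≈⟨ *-congˡ (*-assoc _ _ _) ⟨
        q * (pow (q ⁻¹) (suc k) * C (+ 0))    ∎)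
        where
        C : ℤ → Carrier
        C = Casoratian ℤ.suc x y
        q*[q⁻¹*z]≈z : ∀ z → q * (q ⁻¹ * z) ≈ z
        q*[q⁻¹*z]≈z z = trans (*-congˡ (*-comm _ _)) (x*[y/x]≈y q≉0 z)
        above : ∀ k → C (ℤ.suc -[1+ k ]) ≈ pow (q ⁻¹) k * C (+ 0)
        above zero    = sym (*-identityˡ _)
        above (suc k) = casoratian-powℤ sx sy -[1+ k ]

      cross-differenceℤ : ∀ {x y} → Solution ℤ.suc x → Solution ℤ.suc y → ∀ m d →
        x (m ℤ.+ d) * y m - x m * y (m ℤ.+ d) ≈ u p q d * Casoratian ℤ.suc x y m
      cross-differenceℤ = cross-difference ℤ.suc ℤ._+_ (+ 0) ℤP.+-identityʳ ℤ-+-sucʳ solution-uniqueℤ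
                                           (w-solution 0# 1#) refl refl

    -- The backward recurrence divides by q, so negative indices need q ≉ 0.
    Admissible : ℤ → ℤ → Set ℓ
    Admissible m d = q ≉ 0# ⊎ (+ 0 ℤ.≤ m × + 0 ℤ.≤ d)

    w-cross-shift : ∀ a b c d {m e} → Admissible m e →
      w c d p q (m ℤ.+ e) * w a b p q m - w c d p q m * w a b p q (m ℤ.+ e)
        ≈ u p q e * (powℤ q m * (d * a - c * b))
    w-cross-shift a b c d {m} {e} (inj₁ q≉0) =
      trans (cross-differenceℤ (w-solution c d) (w-solution a b) m e)
            (*-congˡ (casoratian-powℤ (w-solution c d) (w-solution a b) m))
      where open Invertible q≉0
    w-cross-shift a b c d {+ m} {+ e} (inj₂ _) =
      trans (cross-differenceℕ (wNat-solution c d) (wNat-solution a b) m e)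
            (*-congˡ (casoratian-powℕ (wNat-solution c d) (wNat-solution a b) m))

    w-cross : ∀ a b c d {m n} → Admissible m (n ℤ.- m) →
      w c d p q n * w a b p q m - w c d p q m * w a b p q n
        ≈ u p q (n ℤ.- m) * (powℤ q m * (d * a - c * b))
    w-cross a b c d {m} {n} adm = begin
      w c d p q n * w a b p q m - w c d p q m * w a b p q n
        ≡⟨ ≡.cong (λ j → w c d p q j * w a b p q m - w c d p q m * w a b p q j) (m+[n-m]≡n m n) ⟨
      w c d p q (m ℤ.+ (n ℤ.- m)) * w a b p q m - w c d p q m * w a b p q (m ℤ.+ (n ℤ.- m))
        ≈⟨ w-cross-shift a b c d adm ⟩
      u p q (n ℤ.- m) * (powℤ q m * (d * a - c * b)) ∎

    w-linear : ∀ a b n → w a b p q n ≈ a * w 1# 0# p q n + b * u p q n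
    w-linear a b (+ n)    = nat n
      where
      nat : ∀ n → wNat a b p q n ≈ a * wNat 1# 0# p q n + b * wNat 0# 1# p q n
      nat zero          = solve 2 (λ a b → a := a :* con (+ 1) :+ b :* con (+ 0)) refl a b
      nat (suc zero)    = solve 2 (λ a b → b := a :* con (+ 0) :+ b :* con (+ 1)) refl a b
      nat (suc (suc n)) = trans (+-cong (*-congˡ (nat (suc n))) (-‿cong (*-congˡ (nat n))))
        (solve 8 (λ p q a b s₁ t₁ s₀ t₀ → p :* (a :* s₁ :+ b :* t₁) :- q :* (a :* s₀ :+ b :* t₀)
                                        := a :* (p :* s₁ :- q :* s₀) :+ b :* (p :* t₁ :- q :* t₀))
               refl p q a b _ _ _ _)
    w-linear a b -[1+ n ] = neg (suc n)
      where
      neg : ∀ n → wNeg a b p q n ≈ a * wNeg 1# 0# p q n + b * wNeg 0# 1# p q n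
      neg zero          = solve 2 (λ a b → a := a :* con (+ 1) :+ b :* con (+ 0)) refl a b
      neg (suc zero)    =
        solve 4 (λ a b p r → (p :* a :- b) :* r
                            := a :* ((p :* con (+ 1) :- con (+ 0)) :* r) :+ b :* ((p :* con (+ 0) :- con (+ 1)) :* r))
              refl a b p (q ⁻¹)
      neg (suc (suc n)) = trans (*-congʳ (+-cong (*-congˡ (neg (suc n))) (-‿cong (neg n))))
        (solve 8 (λ p r a b s₁ t₁ s₀ t₀ → (p :* (a :* s₁ :+ b :* t₁) :- (a :* s₀ :+ b :* t₀)) :* r
                                        := a :* ((p :* s₁ :- s₀) :* r) :+ b :* ((p :* t₁ :- t₀) :* r))
               refl p (q ⁻¹) a b _ _ _ _)

  module Summands (a b p q : Carrier) (f : ℕ → ℤ) where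
    open Recurrence p q

    W : ℤ → Carrier
    W = w a b p q

    summand : ℕ → ℕ → Carrier
    summand k i = (powℤ q (f i) * u p q (f (i ℕ.+ k) ℤ.- f i)) / (W (f i) * W (f (i ℕ.+ k)))

    module _ (c d : Carrier) where

      ratio : ℕ → Carrier
      ratio i = w c d p q (f i) / W (f i)

      summand-telescopes : ∀ k i → W (f i) ≉ 0# → W (f (i ℕ.+ k)) ≉ 0# →
        Admissible (f i) (f (i ℕ.+ k) ℤ.- f i) →
        (d * a - c * b) * summand k i ≈ ratio (i ℕ.+ k) - ratio i
      summand-telescopes k i Wᵢ≉0 Wᵢ₊ₖ≉0 adm = begin
        K * (powℤ q m * u p q (n ℤ.- m) / (W m * W n))      ≈⟨ *-assoc _ _ _ ⟨
        K * (powℤ q m * u p q (n ℤ.- m)) / (W m * W n)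
          ≈⟨ *-congʳ (solve 3 (λ K P U → K :* (P :* U) := U :* (P :* K)) refl _ _ _) ⟩
        u p q (n ℤ.- m) * (powℤ q m * K) / (W m * W n)      ≈⟨ *-congʳ (w-cross a b c d {m} {n} adm) ⟨
        (w c d p q n * W m - w c d p q m * W n) / (W m * W n) ≈⟨ /-sub-/ Wᵢ₊ₖ≉0 Wᵢ≉0 _ _ ⟨
        ratio (i ℕ.+ k) - ratio i                           ∎
        where
        K = d * a - c * b
        m = f i
        n = f (i ℕ.+ k)

      sum-telescopes : ∀ k n → (∀ i → 1 ≤ i → i ≤ n ℕ.+ k → W (f i) ≉ 0#) →
        (∀ i → 1 ≤ i → i ≤ n → Admissible (f i) (f (i ℕ.+ k) ℤ.- f i)) →
        (d * a - c * b) * sum1 n (summand k) ≈ sum1 n (λ i → ratio (i ℕ.+ k) - ratio i)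
      sum-telescopes k n W≉0 adm = trans (*-distribˡ-sum1 _ n _) (sum1-cong n (λ i 1≤i i≤n →
        summand-telescopes k i
          (W≉0 i 1≤i (ℕP.m≤n⇒m≤n+o k i≤n))
          (W≉0 (i ℕ.+ k) (ℕP.m≤n⇒m≤n+o k 1≤i) (ℕP.+-monoˡ-≤ k i≤n))
          (adm i 1≤i i≤n)))

-- Of 1 ≤ M, 1 ≤ N only 1 ≤ M + N matters, to make w(f(1)) ≉ 0.
theorem1 : {c ℓ : Level} (F : Field c ℓ) →
    let open Field F in let open Lucas F in
    (a b p q : Carrier) (f : ℕ → ℤ) (M N : ℕ) →
    1 ≤ M → 1 ≤ N →
    ¬ ((p * p - (1# + 1# + 1# + 1#) * q) ≈ 0#) →
    (∀ i → 1 ≤ i → i ≤ M ℕ.+ N → ¬ (w a b p q (f i) ≈ 0#)) →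
    (¬ (q ≈ 0#) ⊎
      ((∀ i → 1 ≤ i → i ≤ M ℕ.+ N → (+ 0) ℤ.≤ f i) ×
       (∀ i → 1 ≤ i → i ≤ N → (+ 0) ℤ.≤ (f (i ℕ.+ M) ℤ.- f i)) ×
       (∀ i → 1 ≤ i → i ≤ M → (+ 0) ℤ.≤ (f (i ℕ.+ N) ℤ.- f i)))) →
    sum1 N (λ i → (powℤ q (f i) * u p q (f (i ℕ.+ M) ℤ.- f i))
                   / (w a b p q (f i) * w a b p q (f (i ℕ.+ M))))
      ≈
    sum1 M (λ i → (powℤ q (f i) * u p q (f (i ℕ.+ N) ℤ.- f i))
                   / (w a b p q (f i) * w a b p q (f (i ℕ.+ N))))
theorem1 F a b p q f M N 1≤M _ _ W≉0 hyp = *-cancelˡ W₁≉0 (begin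
  W (f 1) * sum1 N (summand M)                ≈⟨ *-congʳ K≈W₁ ⟨
  K * sum1 N (summand M)                      ≈⟨ sum-telescopes c d M N W≉0′ admissibleM ⟩
  sum1 N (λ i → ratio c d (i ℕ.+ M) - ratio c d i) ≈⟨ sum1-telescope-swap (ratio c d) M N ⟩
  sum1 M (λ i → ratio c d (i ℕ.+ N) - ratio c d i) ≈⟨ sum-telescopes c d N M W≉0 admissibleN ⟨
  K * sum1 M (summand N)                      ≈⟨ *-congʳ K≈W₁ ⟩
  W (f 1) * sum1 M (summand N)                ∎)
  where
  open Field F
  open Lucas F
  open LucasTelescoping F
  open Summands a b p q f
  open Recurrence p q using (Admissible; w-linear)
  open IntegerCoefficients commutativeRing using (solve; _:+_; _:-_; _:*_; :-_; _:=_)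
  open import Relation.Binary.Reasoning.Setoid setoid

  c d K : Carrier
  c = - u p q (f 1)
  d = w 1# 0# p q (f 1)
  K = d * a - c * b

  K≈W₁ : K ≈ W (f 1)
  K≈W₁ = trans (solve 4 (λ a b z v → z :* a :- (:- v) :* b := a :* z :+ b :* v) refl a b d (u p q (f 1)))
               (sym (w-linear a b (f 1)))

  W₁≉0 : W (f 1) ≉ 0#
  W₁≉0 = W≉0 1 ℕP.≤-refl (ℕP.m≤n⇒m≤n+o N 1≤M)

  W≉0′ : ∀ i → 1 ≤ i → i ≤ N ℕ.+ M → W (f i) ≉ 0#
  W≉0′ i 1≤i i≤N+M = W≉0 i 1≤i (≡.subst (i ≤_) (ℕP.+-comm N M) i≤N+M)

  admissibleM : ∀ i → 1 ≤ i → i ≤ N → Admissible (f i) (f (i ℕ.+ M) ℤ.- f i)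
  admissibleM i 1≤i i≤N = map₂ (λ (nonneg , dM , _) → nonneg i 1≤i (ℕP.m≤n⇒m≤o+n M i≤N) , dM i 1≤i i≤N) hyp

  admissibleN : ∀ i → 1 ≤ i → i ≤ M → Admissible (f i) (f (i ℕ.+ N) ℤ.- f i)
  admissibleN i 1≤i i≤M = map₂ (λ (nonneg , _ , dN) → nonneg i 1≤i (ℕP.m≤n⇒m≤n+o N i≤M) , dN i 1≤i i≤M) hyp
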